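{- For all integers $m,n\ge 0$, $$E_{m,n}(x)=\sum_{\mu=0}^n\sum_{l=\mu}^n\left\{ {l \atop \mu} \right\}\binom{n}{l}E_{m,n-l}\,(x)_\mu.$$
   Context: For a non-negative integer $m$, the truncated Euler polynomials $E_{m,n}(x)$ are defined by the generating function $$\frac{\frac{2t^m}{m!}e^{xt}}{e^t+1-\sum_{j=0}^{m-1}\frac{t^j}{j!}}=\sum_{n=0}^\infty E_{m,n}(x)\frac{t^n}{n!},$$ and the truncated Euler numbers are $E_{m,n}=E_{m,n}(0)$. $\left\{ {n \atop k} \right\}$ denotes the Stirling numbers of the second kind, given by $\frac{(e^t-1)^k}{k!}=\sum_{n=0}^\infty \left\{ {n \atop k} \right\}\frac{t^n}{n!}$. The falling factorial is $(x)_n=x(x-1)\cdots(x-n+1)$ for $n\ge1$, $(x)_0=1$. -}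

module Defs where

open import Data.Nat as ℕ using (ℕ; zero; suc; _∸_; _≤ᵇ_)
open import Data.Nat.Combinatorics using (_C_)
open import Data.Integer using (+_)
open import Data.Rational using (ℚ; _+_; _*_; _-_; 0ℚ; 1ℚ; ½)
open import Data.Vec using (Vec; []; _∷_; head)
open import Data.Bool using (if_then_else_)

ℕtoℚ : ℕ → ℚ
ℕtoℚ n = Data.Rational._/_ (+ n) 1

_^ℚ_ : ℚ → ℕ → ℚ
x ^ℚ zero  = 1ℚ
x ^ℚ suc k = x * (x ^ℚ k)

sumUpTo : ℕ → (ℕ → ℚ) → ℚ
sumUpTo zero    f = f 0
sumUpTo (suc n) f = sumUpTo n f + f (suc n)

sumFromTo : ℕ → ℕ → (ℕ → ℚ) → ℚ
sumFromTo a b f = if b ℕ.<ᵇ a then 0ℚ else sumUpTo (b ∸ a) (λ j → f (a ℕ.+ j))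

stirling2 : ℕ → ℕ → ℕ
stirling2 zero    zero    = 1
stirling2 zero    (suc k) = 0
stirling2 (suc n) zero    = 0
stirling2 (suc n) (suc k) = suc k ℕ.* stirling2 n (suc k) ℕ.+ stirling2 n k

falling : ℚ → ℕ → ℚ
falling x zero    = 1ℚ
falling x (suc n) = falling x n * (x - ℕtoℚ n)

-- Truncated Euler polynomials, from the generating function
--   (2 t^m/m!) e^{xt} / (e^t + 1 - Σ_{j<m} t^j/j!) = Σ_n E_{m,n}(x) t^n/n!.
-- Writing D(t) = e^t + 1 - Σ_{j<m} t^j/j! = Σ_k d_k t^k/k! and
-- N(t) = (2 t^m/m!) e^{xt} = Σ_n N_n t^n/n!, the defining identity
-- N(t) = D(t) · Σ_n E_{m,n}(x) t^n/n! is, coefficientwise,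
--   N_n = Σ_{k=0}^{n} C(n,k) d_k E_{m,n-k}(x),
-- which (d_0 ≠ 0) determines E_{m,n}(x) recursively.

-- d_k : coefficient of t^k/k! in e^t + 1 - Σ_{j<m} t^j/j!
dcoef : ℕ → ℕ → ℚ
dcoef m zero    = if m ℕ.≡ᵇ 0 then ℕtoℚ 2 else 1ℚ
dcoef m (suc k) = if m ≤ᵇ suc k then 1ℚ else 0ℚ

-- 1 / d_0
invd0 : ℕ → ℚ
invd0 zero    = ½
invd0 (suc m) = 1ℚ

-- N_n : coefficient of t^n/n! in (2 t^m/m!) e^{xt}
ncoef : ℕ → ℚ → ℕ → ℚ
ncoef m x n = if m ≤ᵇ n then ℕtoℚ 2 * ℕtoℚ (n C m) * (x ^ℚ (n ∸ m)) else 0ℚ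

private
  corr : ℕ → ℕ → ℕ → ∀ {k} → Vec ℚ k → ℚ
  corr m n i []       = 0ℚ
  corr m n i (e ∷ es) = ℕtoℚ (suc n C suc i) * dcoef m (suc i) * e + corr m n (suc i) es

-- table m x n = [E_{m,n}(x), E_{m,n-1}(x), …, E_{m,0}(x)]
table : ℕ → ℚ → (n : ℕ) → Vec ℚ (suc n)
table m x zero    = (ncoef m x 0 * invd0 m) ∷ []
table m x (suc n) =
  let L = table m x n in
  ((ncoef m x (suc n) - corr m n 0 L) * invd0 m) ∷ L

Epoly : ℕ → ℕ → ℚ → ℚ
Epoly m n x = head (table m x n)

Enum : ℕ → ℕ → ℚ
Enum m n = Epoly m n 0ℚ

{-# OPTIONS --safe #-}
module Submission where

-- Writing ⋆ for the binomial convolution of coefficient sequences, the definition of E_{m,n}(x)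
-- says d ⋆ E(x) = N(x), where d and N(x) are the coefficients of the denominator and of the
-- numerator 2tᵐ/m!·e^{xt}. The numerator is e^{xt} times its value at x = 0, so N(x) = xⁿ ⋆ N(0);
-- as ⋆ is commutative and associative, the sequence xⁿ ⋆ E(0) solves the same recurrence, whose
-- solution is unique because d₀ is invertible. Hence E_{m,n}(x) = Σ_l C(n,l) E_{m,n-l} x^l, and
-- expanding x^l = Σ_μ {l μ} (x)_μ and exchanging the two sums gives the formula.

open import Defs
open import Data.Nat as ℕ using (ℕ; zero; suc; _∸_; _≤_; _<_; _≤ᵇ_; z≤n; s≤s; _!; NonZero)
import Data.Nat.Properties as ℕP
open import Data.Nat.Combinatorics using (_C_; nCk≡n!/k![n-k]!; k![n∸k]!∣n!; nCk≡nC[n∸k]; nCn≡1)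
open import Data.Nat.DivMod using (m/n*n≡m)
open import Data.Nat.Induction using (<-rec)
import Data.Nat.Solver as ℕSolver
open import Algebra.Properties.CommutativeSemigroup ℕP.*-commutativeSemigroup using (x∙yz≈y∙xz)
import Data.Nat.Coprimality as Coprimality
import Data.Integer as ℤ
import Data.Integer.Properties as ℤP
open import Data.Rational using (ℚ; mkℚ; _+_; _*_; _-_; 0ℚ; 1ℚ)
open import Data.Rational.Properties
  using (+-identityˡ; +-identityʳ; +-comm; +-assoc; *-identityˡ; *-comm;
         *-zeroˡ; *-zeroʳ; *-distribˡ-+; +-0-group; normalize-coprime; /-cong)
open import Data.Rational.Solver using (module +-*-Solver)
open import Algebra.Properties.Group +-0-group using (∙-cancelʳ)
open import Data.Vec using (Vec; []; _∷_)
open import Data.Bool using (true; false)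
open import Data.Sum using (inj₁; inj₂)
open import Data.Empty using (⊥-elim)
open import Function using (_∘_)
open import Relation.Nullary using (¬_; Dec; yes; no)
open import Relation.Binary.PropositionalEquality
open ≡-Reasoning
open +-*-Solver

ℕtoℚ≡mkℚ : ∀ n → ℕtoℚ n ≡ mkℚ (ℤ.+ n) 0 (Coprimality.sym (Coprimality.1-coprimeTo n))
ℕtoℚ≡mkℚ n = normalize-coprime _

ℕtoℚ-+ : ∀ a b → ℕtoℚ (a ℕ.+ b) ≡ ℕtoℚ a + ℕtoℚ b
ℕtoℚ-+ a b rewrite ℕtoℚ≡mkℚ a | ℕtoℚ≡mkℚ b =
  /-cong {ℤ.+ (a ℕ.+ b)} {1} (sym (cong₂ ℤ._+_ (ℤP.*-identityʳ (ℤ.+ a)) (ℤP.*-identityʳ (ℤ.+ b)))) refl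

ℕtoℚ-* : ∀ a b → ℕtoℚ (a ℕ.* b) ≡ ℕtoℚ a * ℕtoℚ b
ℕtoℚ-* a b rewrite ℕtoℚ≡mkℚ a | ℕtoℚ≡mkℚ b = /-cong {ℤ.+ (a ℕ.* b)} {1} (ℤP.pos-* a b) refl

∸-swap : ∀ n k l → n ∸ k ∸ l ≡ n ∸ l ∸ k
∸-swap n k l = begin
  n ∸ k ∸ l     ≡⟨ ℕP.∸-+-assoc n k l ⟩
  n ∸ (k ℕ.+ l) ≡⟨ cong (n ∸_) (ℕP.+-comm k l) ⟩
  n ∸ (l ℕ.+ k) ≡⟨ ℕP.∸-+-assoc n l k ⟨
  n ∸ l ∸ k     ∎

nCk*k!*[n∸k]!≡n! : ∀ {n k} → k ≤ n → (n C k) ℕ.* (k ! ℕ.* (n ∸ k) !) ≡ n !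
nCk*k!*[n∸k]!≡n! {n} {k} k≤n =
  trans (cong (ℕ._* (k ! ℕ.* (n ∸ k) !)) (nCk≡n!/k![n-k]! k≤n)) (m/n*n≡m (k![n∸k]!∣n! k≤n))
  where instance _ = ℕP._!*_!≢0 k (n ∸ k)

multinomial : ∀ {n k l} → k ℕ.+ l ≤ n →
  (n C k) ℕ.* ((n ∸ k) C l) ℕ.* (k ! ℕ.* (l ! ℕ.* (n ∸ k ∸ l) !)) ≡ n !
multinomial {n} {k} {l} k+l≤n = begin
  (n C k) ℕ.* ((n ∸ k) C l) ℕ.* (k ! ℕ.* (l ! ℕ.* (n ∸ k ∸ l) !))
    ≡⟨ regroup (n C k) ((n ∸ k) C l) (k !) (l !) ((n ∸ k ∸ l) !) ⟩
  (n C k) ℕ.* (k ! ℕ.* (((n ∸ k) C l) ℕ.* (l ! ℕ.* (n ∸ k ∸ l) !)))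
    ≡⟨ cong (λ z → (n C k) ℕ.* (k ! ℕ.* z)) (nCk*k!*[n∸k]!≡n! l≤n∸k) ⟩
  (n C k) ℕ.* (k ! ℕ.* (n ∸ k) !)
    ≡⟨ nCk*k!*[n∸k]!≡n! (ℕP.≤-trans (ℕP.m≤m+n k l) k+l≤n) ⟩
  n ! ∎
  where
  open ℕSolver.+-*-Solver using () renaming (solve to ℕsolve; _:*_ to _⊛_; _:=_ to _≔_)
  regroup : ∀ a b c d e → a ℕ.* b ℕ.* (c ℕ.* (d ℕ.* e)) ≡ a ℕ.* (c ℕ.* (b ℕ.* (d ℕ.* e)))
  regroup = ℕsolve 5 (λ a b c d e → a ⊛ b ⊛ (c ⊛ (d ⊛ e)) ≔ a ⊛ (c ⊛ (b ⊛ (d ⊛ e)))) refl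
  l≤n∸k : l ≤ n ∸ k
  l≤n∸k = subst (_≤ n ∸ k) (ℕP.m+n∸m≡n k l) (ℕP.∸-monoˡ-≤ k k+l≤n)

nCk*[n∸k]Cl≡nCl*[n∸l]Ck : ∀ {n k l} → k ℕ.+ l ≤ n →
  (n C k) ℕ.* ((n ∸ k) C l) ≡ (n C l) ℕ.* ((n ∸ l) C k)
nCk*[n∸k]Cl≡nCl*[n∸l]Ck {n} {k} {l} k+l≤n =
  ℕP.*-cancelʳ-≡ _ _ (k ! ℕ.* (l ! ℕ.* r !)) (begin
    (n C k) ℕ.* ((n ∸ k) C l) ℕ.* (k ! ℕ.* (l ! ℕ.* r !))
      ≡⟨ multinomial {n} {k} {l} k+l≤n ⟩
    n !
      ≡⟨ multinomial {n} {l} {k} (subst (_≤ n) (ℕP.+-comm k l) k+l≤n) ⟨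
    (n C l) ℕ.* ((n ∸ l) C k) ℕ.* (l ! ℕ.* (k ! ℕ.* (n ∸ l ∸ k) !))
      ≡⟨ cong (λ z → (n C l) ℕ.* ((n ∸ l) C k) ℕ.* z) (swap-factorials (k !) (l !) (∸-swap n l k)) ⟩
    (n C l) ℕ.* ((n ∸ l) C k) ℕ.* (k ! ℕ.* (l ! ℕ.* r !)) ∎)
  where
  r = n ∸ k ∸ l
  instance
    _ : NonZero (k ! ℕ.* (l ! ℕ.* r !))
    _ = ℕP.m*n≢0 (k !) (l ! ℕ.* r !) {{ℕP._!≢0 k}} {{ℕP._!*_!≢0 l r}}
  swap-factorials : ∀ a b {s t} → s ≡ t → b ℕ.* (a ℕ.* s !) ≡ a ℕ.* (b ℕ.* t !)
  swap-factorials a b {s} refl = x∙yz≈y∙xz b a (s !)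

Σ : ℕ → (ℕ → ℚ) → ℚ
Σ zero    f = 0ℚ
Σ (suc n) f = Σ n f + f n

Σ-cong : ∀ n {f g : ℕ → ℚ} → (∀ i → i < n → f i ≡ g i) → Σ n f ≡ Σ n g
Σ-cong zero    f≡g = refl
Σ-cong (suc n) f≡g = cong₂ _+_ (Σ-cong n (λ i i<n → f≡g i (ℕP.m<n⇒m<1+n i<n))) (f≡g n (ℕP.n<1+n n))

Σ-zero : ∀ n (f : ℕ → ℚ) → (∀ i → i < n → f i ≡ 0ℚ) → Σ n f ≡ 0ℚ
Σ-zero zero    f f≡0 = refl
Σ-zero (suc n) f f≡0 =
  cong₂ _+_ (Σ-zero n f (λ i i<n → f≡0 i (ℕP.m<n⇒m<1+n i<n))) (f≡0 n (ℕP.n<1+n n))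

Σ-+ : ∀ n (f g : ℕ → ℚ) → Σ n (λ i → f i + g i) ≡ Σ n f + Σ n g
Σ-+ zero    f g = refl
Σ-+ (suc n) f g = trans (cong (_+ (f n + g n)) (Σ-+ n f g))
  (solve 4 (λ a b c d → (a :+ b) :+ (c :+ d) := (a :+ c) :+ (b :+ d)) refl (Σ n f) (Σ n g) (f n) (g n))

*-distribˡ-Σ : ∀ n c (f : ℕ → ℚ) → c * Σ n f ≡ Σ n (λ i → c * f i)
*-distribˡ-Σ zero    c f = *-zeroʳ c
*-distribˡ-Σ (suc n) c f = trans (*-distribˡ-+ c (Σ n f) (f n)) (cong (_+ c * f n) (*-distribˡ-Σ n c f))

Σ-suc : ∀ n (f : ℕ → ℚ) → Σ (suc n) f ≡ f 0 + Σ n (λ i → f (suc i))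
Σ-suc zero    f = trans (+-identityˡ (f 0)) (sym (+-identityʳ (f 0)))
Σ-suc (suc n) f = trans (cong (_+ f (suc n)) (Σ-suc n f)) (+-assoc (f 0) _ _)

Σ-split : ∀ a b (f : ℕ → ℚ) → Σ (a ℕ.+ b) f ≡ Σ a f + Σ b (λ j → f (a ℕ.+ j))
Σ-split a zero    f = trans (cong (λ n → Σ n f) (ℕP.+-identityʳ a)) (sym (+-identityʳ (Σ a f)))
Σ-split a (suc b) f = begin
  Σ (a ℕ.+ suc b) f                                  ≡⟨ cong (λ n → Σ n f) (ℕP.+-suc a b) ⟩
  Σ (a ℕ.+ b) f + f (a ℕ.+ b)                        ≡⟨ cong (_+ f (a ℕ.+ b)) (Σ-split a b f) ⟩
  Σ a f + Σ b (λ j → f (a ℕ.+ j)) + f (a ℕ.+ b)      ≡⟨ +-assoc (Σ a f) _ _ ⟩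
  Σ a f + Σ (suc b) (λ j → f (a ℕ.+ j))              ∎

Σ-swap : ∀ n k (g : ℕ → ℕ → ℚ) → Σ n (λ i → Σ k (g i)) ≡ Σ k (λ j → Σ n (λ i → g i j))
Σ-swap zero    k g = sym (Σ-zero k _ (λ _ _ → refl))
Σ-swap (suc n) k g = trans (cong (_+ Σ k (g n)) (Σ-swap n k g)) (sym (Σ-+ k _ (g n)))

Σ-reverse : ∀ n (f : ℕ → ℚ) → Σ (suc n) f ≡ Σ (suc n) (λ i → f (n ∸ i))
Σ-reverse zero    f = refl
Σ-reverse (suc n) f = begin
  Σ (suc (suc n)) f                                  ≡⟨ Σ-suc (suc n) f ⟩
  f 0 + Σ (suc n) (λ i → f (suc i))                  ≡⟨ cong (f 0 +_) (Σ-reverse n (λ i → f (suc i))) ⟩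
  f 0 + Σ (suc n) (λ i → f (suc (n ∸ i)))            ≡⟨ +-comm (f 0) _ ⟩
  Σ (suc n) (λ i → f (suc (n ∸ i))) + f 0            ≡⟨ cong₂ _+_ (Σ-cong (suc n) suc[n∸i]) (cong f (sym (ℕP.n∸n≡0 n))) ⟩
  Σ (suc (suc n)) (λ i → f (suc n ∸ i))              ∎
  where
  suc[n∸i] : ∀ i → i < suc n → f (suc (n ∸ i)) ≡ f (suc n ∸ i)
  suc[n∸i] i i<1+n = cong f (sym (ℕP.+-∸-assoc 1 (ℕP.≤-pred i<1+n)))

Σ-delta : ∀ n j (f : ℕ → ℚ) → j < n → (∀ i → i < n → i ≢ j → f i ≡ 0ℚ) → Σ n f ≡ f j
Σ-delta (suc n) j f j<1+n f≡0 with ℕP.m<1+n⇒m<n∨m≡n j<1+n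
... | inj₁ j<n = trans
  (cong₂ _+_ (Σ-delta n j f j<n (λ i i<n → f≡0 i (ℕP.m<n⇒m<1+n i<n)))
             (f≡0 n (ℕP.n<1+n n) (ℕP.<⇒≢ j<n ∘ sym)))
  (+-identityʳ (f j))
... | inj₂ refl = trans
  (cong (_+ f j) (Σ-zero j f (λ i i<j → f≡0 i (ℕP.m<n⇒m<1+n i<j) (ℕP.<⇒≢ i<j))))
  (+-identityˡ (f j))

Σ-triangle-swap : ∀ n (g : ℕ → ℕ → ℚ) →
  Σ (suc n) (λ k → Σ (suc (n ∸ k)) (g k)) ≡ Σ (suc n) (λ l → Σ (suc (n ∸ l)) (λ k → g k l))
Σ-triangle-swap n g = begin
  Σ (suc n) (λ k → Σ (suc (n ∸ k)) (g k))          ≡⟨ Σ-cong (suc n) (λ k k≤n → cong (λ r → Σ r (g k)) (1+n∸k k≤n)) ⟨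
  triangle (suc n) g                               ≡⟨ triangle-transpose (suc n) g ⟩
  triangle (suc n) (λ l k → g k l)                 ≡⟨ Σ-cong (suc n) (λ l l≤n → cong (λ r → Σ r (λ k → g k l)) (1+n∸k l≤n)) ⟩
  Σ (suc n) (λ l → Σ (suc (n ∸ l)) (λ k → g k l))  ∎
  where
  1+n∸k : ∀ {k} → k < suc n → suc n ∸ k ≡ suc (n ∸ k)
  1+n∸k k≤n = ℕP.+-∸-assoc 1 (ℕP.≤-pred k≤n)

  triangle : ℕ → (ℕ → ℕ → ℚ) → ℚ
  triangle N h = Σ N (λ k → Σ (N ∸ k) (h k))

  triangle-suc : ∀ N h → triangle (suc N) h ≡ triangle N h + Σ (suc N) (λ k → h k (N ∸ k))
  triangle-suc N h = begin
    Σ N (λ k → Σ (suc N ∸ k) (h k)) + Σ (suc N ∸ N) (h N)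
      ≡⟨ cong₂ (λ a b → a + Σ b (h N))
           (Σ-cong N (λ k k<N → cong (λ r → Σ r (h k)) (ℕP.+-∸-assoc 1 (ℕP.<⇒≤ k<N)))) (ℕP.m+n∸n≡m 1 N) ⟩
    Σ N (λ k → Σ (N ∸ k) (h k) + h k (N ∸ k)) + (0ℚ + h N 0)
      ≡⟨ cong₂ _+_ (Σ-+ N _ _) (trans (+-identityˡ _) (cong (h N) (sym (ℕP.n∸n≡0 N)))) ⟩
    triangle N h + Σ N (λ k → h k (N ∸ k)) + h N (N ∸ N)
      ≡⟨ +-assoc (triangle N h) _ _ ⟩
    triangle N h + Σ (suc N) (λ k → h k (N ∸ k)) ∎

  antidiagonal-transpose : ∀ N h → Σ (suc N) (λ k → h k (N ∸ k)) ≡ Σ (suc N) (λ l → h (N ∸ l) l)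
  antidiagonal-transpose N h = trans (Σ-reverse N _)
    (Σ-cong (suc N) (λ l l≤N → cong (h (N ∸ l)) (ℕP.m∸[m∸n]≡n (ℕP.≤-pred l≤N))))

  triangle-transpose : ∀ N h → triangle N h ≡ triangle N (λ l k → h k l)
  triangle-transpose zero    h = refl
  triangle-transpose (suc N) h = begin
    triangle (suc N) h                                             ≡⟨ triangle-suc N h ⟩
    triangle N h + Σ (suc N) (λ k → h k (N ∸ k))                   ≡⟨ cong₂ _+_ (triangle-transpose N h) (antidiagonal-transpose N h) ⟩
    triangle N (λ l k → h k l) + Σ (suc N) (λ l → h (N ∸ l) l)     ≡⟨ triangle-suc N (λ l k → h k l) ⟨
    triangle (suc N) (λ l k → h k l)                               ∎

infixl 7 _⋆_

-- Coefficients of the product of the exponential generating functions of a and b.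
_⋆_ : (ℕ → ℚ) → (ℕ → ℚ) → ℕ → ℚ
(a ⋆ b) n = Σ (suc n) (λ k → ℕtoℚ (n C k) * a k * b (n ∸ k))

⋆-congʳ : ∀ a {b c} → (∀ k → b k ≡ c k) → ∀ n → (a ⋆ b) n ≡ (a ⋆ c) n
⋆-congʳ a b≡c n = Σ-cong (suc n) (λ k _ → cong (ℕtoℚ (n C k) * a k *_) (b≡c (n ∸ k)))

⋆-leftComm : ∀ a b c n → (a ⋆ (b ⋆ c)) n ≡ (b ⋆ (a ⋆ c)) n
⋆-leftComm a b c n = begin
  (a ⋆ (b ⋆ c)) n                                  ≡⟨ expand a b ⟩
  Σ (suc n) (λ k → Σ (suc (n ∸ k)) (term a b k))   ≡⟨ Σ-triangle-swap n (term a b) ⟩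
  Σ (suc n) (λ l → Σ (suc (n ∸ l)) (λ k → term a b k l))
    ≡⟨ Σ-cong (suc n) (λ l l≤n → Σ-cong (suc (n ∸ l)) (λ k k≤n∸l →
         term-transpose k l (subst (k ℕ.+ l ≤_) (ℕP.m∸n+n≡m (ℕP.≤-pred l≤n))
                                                 (ℕP.+-monoˡ-≤ l (ℕP.≤-pred k≤n∸l))))) ⟩
  Σ (suc n) (λ l → Σ (suc (n ∸ l)) (term b a l))   ≡⟨ expand b a ⟨
  (b ⋆ (a ⋆ c)) n                                  ∎
  where
  term : (ℕ → ℚ) → (ℕ → ℚ) → ℕ → ℕ → ℚ
  term a b k l = ℕtoℚ (n C k) * a k * (ℕtoℚ ((n ∸ k) C l) * b l * c (n ∸ k ∸ l))

  expand : ∀ a b → (a ⋆ (b ⋆ c)) n ≡ Σ (suc n) (λ k → Σ (suc (n ∸ k)) (term a b k))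
  expand a b = Σ-cong (suc n) (λ k _ → *-distribˡ-Σ (suc (n ∸ k)) (ℕtoℚ (n C k) * a k) _)

  regroup : ∀ p u q v w → p * u * (q * v * w) ≡ p * q * (u * v * w)
  regroup = solve 5 (λ p u q v w → p :* u :* (q :* v :* w) := p :* q :* (u :* v :* w)) refl

  term-transpose : ∀ k l → k ℕ.+ l ≤ n → term a b k l ≡ term b a l k
  term-transpose k l k+l≤n = begin
    term a b k l
      ≡⟨ regroup (ℕtoℚ (n C k)) (a k) (ℕtoℚ ((n ∸ k) C l)) (b l) (c (n ∸ k ∸ l)) ⟩
    ℕtoℚ (n C k) * ℕtoℚ ((n ∸ k) C l) * (a k * b l * c (n ∸ k ∸ l))
      ≡⟨ cong (_* (a k * b l * c (n ∸ k ∸ l))) (ℕtoℚ-* (n C k) ((n ∸ k) C l)) ⟨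
    ℕtoℚ ((n C k) ℕ.* ((n ∸ k) C l)) * (a k * b l * c (n ∸ k ∸ l))
      ≡⟨ cong₂ (λ N r → ℕtoℚ N * (a k * b l * c r)) (nCk*[n∸k]Cl≡nCl*[n∸l]Ck {n} {k} {l} k+l≤n) (∸-swap n k l) ⟩
    ℕtoℚ ((n C l) ℕ.* ((n ∸ l) C k)) * (a k * b l * c (n ∸ l ∸ k))
      ≡⟨ cong₂ (λ p u → p * (u * c (n ∸ l ∸ k))) (ℕtoℚ-* (n C l) ((n ∸ l) C k)) (*-comm (a k) (b l)) ⟩
    ℕtoℚ (n C l) * ℕtoℚ ((n ∸ l) C k) * (b l * a k * c (n ∸ l ∸ k))
      ≡⟨ regroup (ℕtoℚ (n C l)) (b l) (ℕtoℚ ((n ∸ l) C k)) (a k) (c (n ∸ l ∸ k)) ⟨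
    term b a l k ∎

⋆-tail : (ℕ → ℚ) → (ℕ → ℚ) → ℕ → ℚ
⋆-tail a b n = Σ n (λ t → ℕtoℚ (n C suc t) * a (suc t) * b (n ∸ suc t))

-- ℕtoℚ (n C 0) computes to 1ℚ.
⋆≡head+tail : ∀ a b n → (a ⋆ b) n ≡ 1ℚ * a 0 * b n + ⋆-tail a b n
⋆≡head+tail a b n = Σ-suc n _

⋆-cancelˡ : ∀ a {a₀⁻¹} → a₀⁻¹ * a 0 ≡ 1ℚ →
  ∀ {b c} → (∀ n → (a ⋆ b) n ≡ (a ⋆ c) n) → ∀ n → b n ≡ c n
⋆-cancelˡ a {a₀⁻¹} a₀⁻¹*a₀≡1 {b} {c} a⋆b≡a⋆c = <-rec (λ n → b n ≡ c n) step
  where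
  recover : ∀ f n → a₀⁻¹ * (1ℚ * a 0 * f n) ≡ f n
  recover f n = begin
    a₀⁻¹ * (1ℚ * a 0 * f n) ≡⟨ solve 3 (λ i a x → i :* (con 1ℚ :* a :* x) := i :* a :* x) refl a₀⁻¹ (a 0) (f n) ⟩
    a₀⁻¹ * a 0 * f n        ≡⟨ cong (_* f n) a₀⁻¹*a₀≡1 ⟩
    1ℚ * f n                ≡⟨ *-identityˡ (f n) ⟩
    f n                     ∎

  step : ∀ n → (∀ {j} → j < n → b j ≡ c j) → b n ≡ c n
  step n ih = begin
    b n                       ≡⟨ recover b n ⟨
    a₀⁻¹ * (1ℚ * a 0 * b n)   ≡⟨ cong (a₀⁻¹ *_) leading-terms ⟩
    a₀⁻¹ * (1ℚ * a 0 * c n)   ≡⟨ recover c n ⟩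
    c n                       ∎
    where
    tails : ⋆-tail a b n ≡ ⋆-tail a c n
    tails = Σ-cong n (λ t t<n → cong (ℕtoℚ (n C suc t) * a (suc t) *_) (ih (ℕP.∸-monoʳ-< (s≤s z≤n) t<n)))

    leading-terms : 1ℚ * a 0 * b n ≡ 1ℚ * a 0 * c n
    leading-terms = ∙-cancelʳ (⋆-tail a b n) _ _ (begin
      1ℚ * a 0 * b n + ⋆-tail a b n ≡⟨ ⋆≡head+tail a b n ⟨
      (a ⋆ b) n                     ≡⟨ a⋆b≡a⋆c n ⟩
      (a ⋆ c) n                     ≡⟨ ⋆≡head+tail a c n ⟩
      1ℚ * a 0 * c n + ⋆-tail a c n ≡⟨ cong (1ℚ * a 0 * c n +_) tails ⟨
      1ℚ * a 0 * c n + ⋆-tail a b n ∎)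

stirling2-vanish : ∀ {l μ} → l < μ → stirling2 l μ ≡ 0
stirling2-vanish {zero}  {suc μ} _         = refl
stirling2-vanish {suc l} {suc μ} (s≤s l<μ)
  rewrite stirling2-vanish (ℕP.m<n⇒m<1+n l<μ) | stirling2-vanish l<μ =
    trans (ℕP.+-identityʳ _) (ℕP.*-zeroʳ (suc μ))

pow-as-Σ-falling : ∀ x l N → l < N → Σ N (λ μ → ℕtoℚ (stirling2 l μ) * falling x μ) ≡ x ^ℚ l
pow-as-Σ-falling x zero (suc N) _ = begin
  Σ (suc N) (λ μ → ℕtoℚ (stirling2 0 μ) * falling x μ) ≡⟨ Σ-suc N _ ⟩
  1ℚ * 1ℚ + Σ N (λ μ → 0ℚ * falling x (suc μ))         ≡⟨ cong (1ℚ +_) (Σ-zero N _ (λ μ _ → *-zeroˡ (falling x (suc μ)))) ⟩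
  1ℚ + 0ℚ                                              ≡⟨ +-identityʳ 1ℚ ⟩
  1ℚ                                                   ∎
pow-as-Σ-falling x (suc l) (suc N) (s≤s l<N) = begin
  Σ (suc N) (term (suc l))                              ≡⟨ Σ-suc N (term (suc l)) ⟩
  0ℚ * 1ℚ + Σ N (λ μ → term (suc l) (suc μ))            ≡⟨ +-identityˡ _ ⟩
  Σ N (λ μ → term (suc l) (suc μ))                      ≡⟨ Σ-cong N (λ μ _ → stirling-recurrence μ) ⟩
  Σ N (λ μ → weighted (suc μ) + shifted μ)              ≡⟨ Σ-+ N _ _ ⟩
  Σ N (λ μ → weighted (suc μ)) + Σ N shifted            ≡⟨ cong (_+ Σ N shifted) weighted-shift ⟩
  Σ N weighted + Σ N shifted                            ≡⟨ +-comm (Σ N weighted) _ ⟩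
  Σ N shifted + Σ N weighted                            ≡⟨ Σ-+ N _ _ ⟨
  Σ N (λ μ → shifted μ + weighted μ)                    ≡⟨ Σ-cong N (λ μ _ → falling-recurrence μ) ⟩
  Σ N (λ μ → x * term l μ)                              ≡⟨ *-distribˡ-Σ N x (term l) ⟨
  x * Σ N (term l)                                      ≡⟨ cong (x *_) (pow-as-Σ-falling x l N l<N) ⟩
  x * x ^ℚ l                                            ∎
  where
  S : ℕ → ℕ → ℚ
  S j μ = ℕtoℚ (stirling2 j μ)

  term : ℕ → ℕ → ℚ
  term j μ = S j μ * falling x μ

  weighted shifted : ℕ → ℚ
  weighted μ = ℕtoℚ μ * S l μ * falling x μ
  shifted μ = S l μ * falling x (suc μ)

  stirling-recurrence : ∀ μ → term (suc l) (suc μ) ≡ weighted (suc μ) + shifted μ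
  stirling-recurrence μ
    rewrite ℕtoℚ-+ (suc μ ℕ.* stirling2 l (suc μ)) (stirling2 l μ) | ℕtoℚ-* (suc μ) (stirling2 l (suc μ)) =
    solve 4 (λ m s s′ f → (m :* s :+ s′) :* f := m :* s :* f :+ s′ :* f) refl
      (ℕtoℚ (suc μ)) (S l (suc μ)) (S l μ) (falling x (suc μ))

  falling-recurrence : ∀ μ → shifted μ + weighted μ ≡ x * term l μ
  falling-recurrence μ =
    solve 4 (λ s f m x → s :* (f :* (x :- m)) :+ m :* s :* f := x :* (s :* f)) refl
      (S l μ) (falling x μ) (ℕtoℚ μ) x

  weighted-shift : Σ N (λ μ → weighted (suc μ)) ≡ Σ N weighted
  weighted-shift = begin
    Σ N (λ μ → weighted (suc μ))                  ≡⟨ +-identityˡ _ ⟨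
    0ℚ + Σ N (λ μ → weighted (suc μ))             ≡⟨ cong (_+ Σ N (λ μ → weighted (suc μ))) weighted-0 ⟨
    weighted 0 + Σ N (λ μ → weighted (suc μ))     ≡⟨ Σ-suc N weighted ⟨
    Σ N weighted + weighted N                     ≡⟨ cong (Σ N weighted +_) weighted-N ⟩
    Σ N weighted + 0ℚ                             ≡⟨ +-identityʳ _ ⟩
    Σ N weighted                                  ∎
    where
    weighted-0 : weighted 0 ≡ 0ℚ
    weighted-0 = trans (cong (_* falling x 0) (*-zeroˡ (S l 0))) (*-zeroˡ (falling x 0))
    weighted-N : weighted N ≡ 0ℚ
    weighted-N rewrite stirling2-vanish l<N =
      trans (cong (_* falling x N) (*-zeroʳ (ℕtoℚ N))) (*-zeroˡ (falling x N))

invd0*dcoef0≡1 : ∀ m → invd0 m * dcoef m 0 ≡ 1ℚ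
invd0*dcoef0≡1 zero    = refl
invd0*dcoef0≡1 (suc m) = refl

-- A public copy of the private corr of Defs.
weightedSum : ℕ → ℕ → ℕ → ∀ {k} → Vec ℚ k → ℚ
weightedSum m n i []       = 0ℚ
weightedSum m n i (e ∷ es) = ℕtoℚ (suc n C suc i) * dcoef m (suc i) * e + weightedSum m n (suc i) es

weightedSum-unique : ∀ m n (c : ℕ → ∀ {k} → Vec ℚ k → ℚ) → (∀ i → c i [] ≡ 0ℚ) →
  (∀ i e {k} (es : Vec ℚ k) → c i (e ∷ es) ≡ ℕtoℚ (suc n C suc i) * dcoef m (suc i) * e + c (suc i) es) →
  ∀ i {k} (v : Vec ℚ k) → c i v ≡ weightedSum m n i v
weightedSum-unique m n c c-[] c-∷ i []       = c-[] i
weightedSum-unique m n c c-[] c-∷ i (e ∷ es) =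
  trans (c-∷ i e es) (cong (ℕtoℚ (suc n C suc i) * dcoef m (suc i) * e +_) (weightedSum-unique m n c c-[] c-∷ (suc i) es))

-- Abstracting the arguments of corr turns its occurrence in the unfolded goal into a pattern,
-- from which unification recovers corr as the function argument of weightedSum-unique.
Epoly-suc : ∀ m x n → Epoly m (suc n) x ≡ (ncoef m x (suc n) - weightedSum m n 0 (table m x n)) * invd0 m
Epoly-suc m x n with weightedSum-unique m n _ (λ _ → refl) (λ _ _ _ → refl)
... | corr≡weightedSum with ncoef m x (suc n) | invd0 m
... | N | I with suc n | table m x n
... | k | v with 0
... | i = cong (λ T → (N - T) * I) (corr≡weightedSum i v)

weightedSum-table : ∀ m x n i j → weightedSum m n i (table m x j) ≡
  Σ (suc j) (λ t → ℕtoℚ (suc n C suc (t ℕ.+ i)) * dcoef m (suc (t ℕ.+ i)) * Epoly m (j ∸ t) x)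
weightedSum-table m x n i zero =
  trans (+-identityʳ (ℕtoℚ (suc n C suc i) * dcoef m (suc i) * Epoly m 0 x)) (sym (+-identityˡ _))
weightedSum-table m x n i (suc j) = begin
  weight i * Epoly m (suc j) x + weightedSum m n (suc i) (table m x j)
    ≡⟨ cong (weight i * Epoly m (suc j) x +_) (weightedSum-table m x n (suc i) j) ⟩
  weight i * Epoly m (suc j) x + Σ (suc j) (λ t → weight (t ℕ.+ suc i) * Epoly m (j ∸ t) x)
    ≡⟨ cong (weight i * Epoly m (suc j) x +_)
         (Σ-cong (suc j) (λ t _ → cong (λ s → weight s * Epoly m (j ∸ t) x) (ℕP.+-suc t i))) ⟩
  weight i * Epoly m (suc j) x + Σ (suc j) (λ t → weight (suc t ℕ.+ i) * Epoly m (j ∸ t) x)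
    ≡⟨ Σ-suc (suc j) _ ⟨
  Σ (suc (suc j)) (λ t → weight (t ℕ.+ i) * Epoly m (suc j ∸ t) x) ∎
  where
  weight : ℕ → ℚ
  weight s = ℕtoℚ (suc n C suc s) * dcoef m (suc s)

Epoly≡leading-solution : ∀ m x n →
  Epoly m n x ≡ (ncoef m x n - ⋆-tail (dcoef m) (λ k → Epoly m k x) n) * invd0 m
Epoly≡leading-solution m x zero    = cong (_* invd0 m) (sym (+-identityʳ (ncoef m x 0)))
Epoly≡leading-solution m x (suc n) = trans (Epoly-suc m x n)
  (cong (λ T → (ncoef m x (suc n) - T) * invd0 m)
    (trans (weightedSum-table m x n 0 n)
           (Σ-cong (suc n) (λ t _ → cong (λ s → ℕtoℚ (suc n C suc s) * dcoef m (suc s) * Epoly m (n ∸ t) x)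
                                         (ℕP.+-identityʳ t)))))

Epoly-recurrence : ∀ m x n → (dcoef m ⋆ (λ k → Epoly m k x)) n ≡ ncoef m x n
Epoly-recurrence m x n = begin
  (dcoef m ⋆ E) n                                         ≡⟨ ⋆≡head+tail (dcoef m) E n ⟩
  1ℚ * dcoef m 0 * E n + T                                ≡⟨ cong (λ e → 1ℚ * dcoef m 0 * e + T) (Epoly≡leading-solution m x n) ⟩
  1ℚ * dcoef m 0 * ((ncoef m x n - T) * invd0 m) + T      ≡⟨ regroup (dcoef m 0) (ncoef m x n) T (invd0 m) ⟩
  (ncoef m x n - T) * (invd0 m * dcoef m 0) + T           ≡⟨ cong (λ u → (ncoef m x n - T) * u + T) (invd0*dcoef0≡1 m) ⟩
  (ncoef m x n - T) * 1ℚ + T                              ≡⟨ cancel (ncoef m x n) T ⟩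
  ncoef m x n                                             ∎
  where
  E : ℕ → ℚ
  E k = Epoly m k x
  T : ℚ
  T = ⋆-tail (dcoef m) E n
  regroup : ∀ d N T i → 1ℚ * d * ((N - T) * i) + T ≡ (N - T) * (i * d) + T
  regroup = solve 4 (λ d N T i → con 1ℚ :* d :* ((N :- T) :* i) :+ T := (N :- T) :* (i :* d) :+ T) refl
  cancel : ∀ N T → (N - T) * 1ℚ + T ≡ N
  cancel = solve 2 (λ N T → (N :- T) :* con 1ℚ :+ T := N) refl

ncoef-≤ : ∀ m x {n} → m ≤ n → ncoef m x n ≡ ℕtoℚ 2 * ℕtoℚ (n C m) * x ^ℚ (n ∸ m)
ncoef-≤ m x {n} m≤n with m ≤ᵇ n | ℕP.≤⇒≤ᵇ m≤n
... | true | _ = refl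

ncoef-≰ : ∀ m x {n} → ¬ m ≤ n → ncoef m x n ≡ 0ℚ
ncoef-≰ m x {n} m≰n with m ≤ᵇ n | ℕP.≤ᵇ⇒≤ m n
... | true  | ≤ᵇ⇒≤ = ⊥-elim (m≰n (≤ᵇ⇒≤ _))
... | false | _    = refl

ncoef-0-≢ : ∀ m {k} → k ≢ m → ncoef m 0ℚ k ≡ 0ℚ
ncoef-0-≢ m {k} k≢m with m ℕP.≤? k
... | no  m≰k = ncoef-≰ m 0ℚ m≰k
... | yes m≤k = trans (ncoef-≤ m 0ℚ m≤k) (zero-power (k ∸ m) refl)
  where
  zero-power : ∀ r → r ≡ k ∸ m → ℕtoℚ 2 * ℕtoℚ (k C m) * 0ℚ ^ℚ r ≡ 0ℚ
  zero-power zero    0≡k∸m = ⊥-elim (k≢m (ℕP.≤-antisym (ℕP.m∸n≡0⇒m≤n (sym 0≡k∸m)) m≤k))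
  zero-power (suc r) _     = trans (cong (ℕtoℚ 2 * ℕtoℚ (k C m) *_) (*-zeroˡ (0ℚ ^ℚ r))) (*-zeroʳ (ℕtoℚ 2 * ℕtoℚ (k C m)))

ncoef-0-m : ∀ m → ncoef m 0ℚ m ≡ ℕtoℚ 2
ncoef-0-m m = trans (ncoef-≤ m 0ℚ ℕP.≤-refl)
  (cong₂ (λ c r → ℕtoℚ 2 * ℕtoℚ c * 0ℚ ^ℚ r) (nCn≡1 m) (ℕP.n∸n≡0 m))

ncoef-shift : ∀ m x n → ((x ^ℚ_) ⋆ ncoef m 0ℚ) n ≡ ncoef m x n
ncoef-shift m x n = by-cases (m ℕP.≤? n)
  where
  vanish : ∀ l → n ∸ l ≢ m → ℕtoℚ (n C l) * x ^ℚ l * ncoef m 0ℚ (n ∸ l) ≡ 0ℚ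
  vanish l n∸l≢m = trans (cong (ℕtoℚ (n C l) * x ^ℚ l *_) (ncoef-0-≢ m n∸l≢m)) (*-zeroʳ (ℕtoℚ (n C l) * x ^ℚ l))

  by-cases : Dec (m ≤ n) → ((x ^ℚ_) ⋆ ncoef m 0ℚ) n ≡ ncoef m x n
  by-cases (no m≰n) = trans
    (Σ-zero (suc n) _ (λ l _ → vanish l (λ n∸l≡m → m≰n (subst (_≤ n) n∸l≡m (ℕP.m∸n≤m n l)))))
    (sym (ncoef-≰ m x m≰n))
  by-cases (yes m≤n) = begin
    ((x ^ℚ_) ⋆ ncoef m 0ℚ) n
      ≡⟨ Σ-delta (suc n) (n ∸ m) _ (s≤s (ℕP.m∸n≤m n m)) (λ l l≤n l≢n∸m → vanish l (λ n∸l≡m →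
           l≢n∸m (trans (sym (ℕP.m∸[m∸n]≡n (ℕP.≤-pred l≤n))) (cong (n ∸_) n∸l≡m)))) ⟩
    ℕtoℚ (n C (n ∸ m)) * x ^ℚ (n ∸ m) * ncoef m 0ℚ (n ∸ (n ∸ m))
      ≡⟨ cong₂ (λ c r → ℕtoℚ c * x ^ℚ (n ∸ m) * ncoef m 0ℚ r) (sym (nCk≡nC[n∸k] m≤n)) (ℕP.m∸[m∸n]≡n m≤n) ⟩
    ℕtoℚ (n C m) * x ^ℚ (n ∸ m) * ncoef m 0ℚ m
      ≡⟨ cong (ℕtoℚ (n C m) * x ^ℚ (n ∸ m) *_) (ncoef-0-m m) ⟩
    ℕtoℚ (n C m) * x ^ℚ (n ∸ m) * ℕtoℚ 2
      ≡⟨ solve 3 (λ c p t → c :* p :* t := t :* c :* p) refl (ℕtoℚ (n C m)) (x ^ℚ (n ∸ m)) (ℕtoℚ 2) ⟩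
    ℕtoℚ 2 * ℕtoℚ (n C m) * x ^ℚ (n ∸ m)
      ≡⟨ ncoef-≤ m x m≤n ⟨
    ncoef m x n ∎

Epoly-appell : ∀ m x n → Epoly m n x ≡ ((x ^ℚ_) ⋆ (λ k → Enum m k)) n
Epoly-appell m x = ⋆-cancelˡ (dcoef m) {invd0 m} (invd0*dcoef0≡1 m) same-recurrence
  where
  E : ℚ → ℕ → ℚ
  E y k = Epoly m k y

  same-recurrence : ∀ n → (dcoef m ⋆ E x) n ≡ (dcoef m ⋆ ((x ^ℚ_) ⋆ E 0ℚ)) n
  same-recurrence n = begin
    (dcoef m ⋆ E x) n                 ≡⟨ Epoly-recurrence m x n ⟩
    ncoef m x n                       ≡⟨ ncoef-shift m x n ⟨
    ((x ^ℚ_) ⋆ ncoef m 0ℚ) n           ≡⟨ ⋆-congʳ (x ^ℚ_) (λ k → sym (Epoly-recurrence m 0ℚ k)) n ⟩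
    ((x ^ℚ_) ⋆ (dcoef m ⋆ E 0ℚ)) n    ≡⟨ ⋆-leftComm (x ^ℚ_) (dcoef m) (E 0ℚ) n ⟩
    (dcoef m ⋆ ((x ^ℚ_) ⋆ E 0ℚ)) n    ∎

sumUpTo≡Σ : ∀ n f → sumUpTo n f ≡ Σ (suc n) f
sumUpTo≡Σ zero    f = sym (+-identityˡ (f 0))
sumUpTo≡Σ (suc n) f = cong (_+ f (suc n)) (sumUpTo≡Σ n f)

sumFromTo-leadingZeros : ∀ {a b} f → a ≤ b → (∀ i → i < a → f i ≡ 0ℚ) → sumFromTo a b f ≡ Σ (suc b) f
sumFromTo-leadingZeros {a} {b} f a≤b f≡0 = begin
  sumFromTo a b f                                      ≡⟨ sumFromTo≡Σ ⟩
  Σ (suc (b ∸ a)) (λ j → f (a ℕ.+ j))                  ≡⟨ +-identityˡ _ ⟨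
  0ℚ + Σ (suc (b ∸ a)) (λ j → f (a ℕ.+ j))             ≡⟨ cong (_+ Σ (suc (b ∸ a)) (λ j → f (a ℕ.+ j))) (Σ-zero a f f≡0) ⟨
  Σ a f + Σ (suc (b ∸ a)) (λ j → f (a ℕ.+ j))          ≡⟨ Σ-split a (suc (b ∸ a)) f ⟨
  Σ (a ℕ.+ suc (b ∸ a)) f                              ≡⟨ cong (λ r → Σ r f) (trans (ℕP.+-suc a (b ∸ a)) (cong suc (ℕP.m+[n∸m]≡n a≤b))) ⟩
  Σ (suc b) f                                          ∎
  where
  sumFromTo≡Σ : sumFromTo a b f ≡ Σ (suc (b ∸ a)) (λ j → f (a ℕ.+ j))
  sumFromTo≡Σ with b ℕ.<ᵇ a | ℕP.<ᵇ⇒< b a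
  ... | true  | <ᵇ⇒< = ⊥-elim (ℕP.≤⇒≯ a≤b (<ᵇ⇒< _))
  ... | false | _    = sumUpTo≡Σ (b ∸ a) _

mainTheorem5 : (m n : ℕ) (x : ℚ) →
    Epoly m n x ≡
      sumFromTo 0 n (λ μ → sumFromTo μ n (λ l →
        ℕtoℚ (stirling2 l μ) * ℕtoℚ (n C l) * Enum m (n ∸ l) * falling x μ))
mainTheorem5 m n x = begin
  Epoly m n x                                    ≡⟨ Epoly-appell m x n ⟩
  ((x ^ℚ_) ⋆ (λ k → Enum m k)) n                 ≡⟨ Σ-cong (suc n) expand-power ⟩
  Σ (suc n) (λ l → Σ (suc n) (λ μ → term μ l))   ≡⟨ Σ-swap (suc n) (suc n) (λ l μ → term μ l) ⟩
  Σ (suc n) (λ μ → Σ (suc n) (term μ))           ≡⟨ Σ-cong (suc n) (λ μ μ≤n →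
                                                      sumFromTo-leadingZeros (term μ) (ℕP.≤-pred μ≤n) (term-vanish μ)) ⟨
  Σ (suc n) (λ μ → sumFromTo μ n (term μ))       ≡⟨ sumFromTo-leadingZeros {0} {n} (λ μ → sumFromTo μ n (term μ)) z≤n (λ _ ()) ⟨
  sumFromTo 0 n (λ μ → sumFromTo μ n (term μ))   ∎
  where
  term : ℕ → ℕ → ℚ
  term μ l = ℕtoℚ (stirling2 l μ) * ℕtoℚ (n C l) * Enum m (n ∸ l) * falling x μ

  term-vanish : ∀ μ l → l < μ → term μ l ≡ 0ℚ
  term-vanish μ l l<μ rewrite stirling2-vanish l<μ =
    trans (cong (λ z → z * Enum m (n ∸ l) * falling x μ) (*-zeroˡ (ℕtoℚ (n C l))))
          (trans (cong (_* falling x μ) (*-zeroˡ (Enum m (n ∸ l)))) (*-zeroˡ (falling x μ)))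

  expand-power : ∀ l → l < suc n → ℕtoℚ (n C l) * x ^ℚ l * Enum m (n ∸ l) ≡ Σ (suc n) (λ μ → term μ l)
  expand-power l l≤n = begin
    ℕtoℚ (n C l) * x ^ℚ l * Enum m (n ∸ l)
      ≡⟨ cong (λ p → ℕtoℚ (n C l) * p * Enum m (n ∸ l)) (pow-as-Σ-falling x l (suc n) l≤n) ⟨
    ℕtoℚ (n C l) * Σ (suc n) S * Enum m (n ∸ l)
      ≡⟨ solve 3 (λ c s e → c :* s :* e := c :* e :* s) refl (ℕtoℚ (n C l)) (Σ (suc n) S) (Enum m (n ∸ l)) ⟩
    ℕtoℚ (n C l) * Enum m (n ∸ l) * Σ (suc n) S
      ≡⟨ *-distribˡ-Σ (suc n) (ℕtoℚ (n C l) * Enum m (n ∸ l)) S ⟩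
    Σ (suc n) (λ μ → ℕtoℚ (n C l) * Enum m (n ∸ l) * S μ)
      ≡⟨ Σ-cong (suc n) (λ μ _ → solve 4 (λ c e s f → c :* e :* (s :* f) := s :* c :* e :* f) refl
                                    (ℕtoℚ (n C l)) (Enum m (n ∸ l)) (ℕtoℚ (stirling2 l μ)) (falling x μ)) ⟩
    Σ (suc n) (λ μ → term μ l) ∎
    where
    S : ℕ → ℚ
    S μ = ℕtoℚ (stirling2 l μ) * falling x μ
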